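{- For every integer $k\ge 0$, the Coxeter system $\mathbf{I_2}(2k+1)$ is cube-like.
   Context: $\mathbf{I_2}(m)$ is the Coxeter system $(W,\{s,t\})$ with $W=\langle s,t\mid s^2=t^2=(st)^m=1\rangle$ (the dihedral group of order $2m$; its Cayley graph is a cycle of length $2m$, and for $m=1$ it is a single edge). For a Coxeter system $(W,S)$: $\ell(w)$ is the word length w.r.t. $S$; for $J\subseteq S$, $W_J=\langle J\rangle$, $W^J=\{w\in W\mid \ell(wj)>\ell(w)\ \forall j\in J\}$, and $G(W^J)$ is the graph on $W^J$ with $w\sim w'$ iff $w'=sw$ for some $s\in S$. $\iota_0(H)=\max\{|A|-|B|\mid V(H)=A\sqcup B,\ A,B\text{ independent}\}$. $(W,S)$ is cube-like if there is $J\subseteq S$ with $W_J$ abelian and $\iota_0(G(W^J))>0$. -}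

module Defs where

open import Data.Bool using (Bool; true; false; if_then_else_; _xor_)
open import Data.Nat using (ℕ; zero; suc; _+_; _*_; _∸_; _≤_; _<_; NonZero)
open import Data.Nat.DivMod using (_mod_)
open import Data.Fin using (Fin; toℕ)
open import Data.List using (List; []; _∷_; length)
open import Data.List.Relation.Unary.All using (All)
open import Data.List.Relation.Unary.Unique.Propositional using (Unique)
open import Data.List.Membership.Propositional using (_∈_)
open import Data.Product using (Σ; ∃; _×_; _,_)
open import Data.Sum using (_⊎_)
open import Data.Empty using (⊥)
open import Relation.Nullary using (¬_)
open import Relation.Binary.PropositionalEquality using (_≡_)

data Gen : Set where
  s t : Gen

-- The dihedral group W of I₂(m), m ≥ 1, realised concretely as the group of
-- affine maps x ↦ ε·x + a of ℤ/mℤ (ε = ±1).  An element (neg , a) stands for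
-- x ↦ (if neg then -x else x) + a.  In this model s = (x ↦ -x),
-- t = (x ↦ 1 - x), st = (x ↦ x - 1) has order m, so s² = t² = (st)^m = 1 and
-- |W| = 2m: this is exactly ⟨s,t | s²=t²=(st)^m=1⟩.  For m = 1 we get s = t.
W : ℕ → Set
W m = Bool × Fin m

module _ (m : ℕ) .{{_ : NonZero m}} where

  -- group multiplication (composition of maps: (u · v)(x) = u(v(x)))
  mul : W m → W m → W m
  mul (e₁ , a₁) (e₂ , a₂) =
    (e₁ xor e₂ , (toℕ a₁ + (if e₁ then m ∸ toℕ a₂ else toℕ a₂)) mod m)

  one : W m
  one = (false , 0 mod m)

  gen : Gen → W m
  gen s = (true , 0 mod m)
  gen t = (true , 1 mod m)

  eval : List Gen → W m
  eval []      = one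
  eval (g ∷ w) = mul (gen g) (eval w)

  IsLength : W m → ℕ → Set
  IsLength w n =
    (Σ (List Gen) λ word → length word ≡ n × eval word ≡ w)
    × (∀ word → eval word ≡ w → n ≤ length word)

  Subset : Set
  Subset = Gen → Bool

  InParabolic : Subset → W m → Set
  InParabolic J w =
    Σ (List Gen) λ word → All (λ g → J g ≡ true) word × eval word ≡ w

  ParabolicAbelian : Subset → Set
  ParabolicAbelian J =
    ∀ u v → InParabolic J u → InParabolic J v → mul u v ≡ mul v u

  InMinCoset : Subset → W m → Set
  InMinCoset J w =
    ∀ j → J j ≡ true → ∀ a b → IsLength w a → IsLength (mul w (gen j)) b → a < b

  Adjacent : W m → W m → Set
  Adjacent w w' = ∃ λ g → w' ≡ mul (gen g) w

  Independent : List (W m) → Set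
  Independent A = ∀ w w' → w ∈ A → w' ∈ A → ¬ Adjacent w w'

  IsIndependentBipartition : Subset → List (W m) → List (W m) → Set
  IsIndependentBipartition J A B =
    Unique A × Unique B
    × (∀ w → InMinCoset J w → w ∈ A ⊎ w ∈ B)
    × (∀ w → w ∈ A → InMinCoset J w)
    × (∀ w → w ∈ B → InMinCoset J w)
    × (∀ w → w ∈ A → w ∈ B → ⊥)
    × Independent A × Independent B

  -- ι₀(G(W^J)) > 0, i.e. the maximum of |A| - |B| over such bipartitions is
  -- positive, i.e. some such bipartition has |A| > |B|
  Iota0Positive : Subset → Set
  Iota0Positive J =
    Σ (List (W m)) λ A → Σ (List (W m)) λ B →
      IsIndependentBipartition J A B × length B < length A

  CubeLike : Set
  CubeLike = Σ Subset λ J → ParabolicAbelian J × Iota0Positive J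

module Submission where

-- The Cayley graph of I₂(m) is a 2m-cycle.  Placing w at its position p on the cycle, every
-- generator moves p by ±1 and alternating words walk around the cycle in either direction, so
-- ℓ(w) = min (p, 2m − p).  Right multiplication by s is the reflection p ↦ 1 − p of the cycle,
-- hence for J = {s} the set W^J consists of the identity and the elements at positions
-- m < p < 2m, while W_J = {1, s} is abelian.  Left multiplication by a generator exchanges
-- rotations and reflections, so these two classes of W^J form an independent bipartition of
-- G(W^J).  When m = 2k + 1 the reflection sρᶜ (position 2c + 1) lies in W^J exactly when the
-- rotation ρᶜ (position 2c) does, i.e. when k < c; so the rotations of W^J are the identity
-- together with the images under s of the reflections, one more than the reflections.

open import Defs
open import Data.Bool using (true; false; not)
open import Data.Bool.Properties using (not-involutive; not-¬)
open import Data.Empty using (⊥; ⊥-elim)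
open import Data.Fin using (Fin; toℕ; fromℕ<) renaming (zero to fzero; suc to fsuc)
open import Data.Fin.Properties using (toℕ<n; toℕ-fromℕ<; toℕ-injective)
open import Data.List using (List; []; _∷_; length; map; tabulate)
open import Data.List.Properties using (length-map)
open import Data.List.Membership.Propositional using (_∈_)
open import Data.List.Membership.Propositional.Properties using (∈-tabulate⁺; ∈-tabulate⁻; ∈-map⁺; ∈-map⁻)
open import Data.List.Relation.Unary.All using (All; []; _∷_)
import Data.List.Relation.Unary.All as All
open import Data.List.Relation.Unary.AllPairs using (_∷_)
open import Data.List.Relation.Unary.Any using (here; there)
open import Data.List.Relation.Unary.Unique.Propositional using (Unique)
import Data.List.Relation.Unary.Unique.Propositional.Properties as Unique
open import Data.Nat
open import Data.Nat.DivMod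
open import Data.Nat.Properties
open import Data.Product using (Σ; ∃; _×_; _,_; proj₁; proj₂)
open import Data.Sum using (_⊎_; inj₁; inj₂)
import Data.Sum as Sum
open import Function using (_∘_)
open import Relation.Nullary using (¬_; yes; no)
open import Relation.Binary.PropositionalEquality using (_≡_; _≢_; refl; sym; trans; cong; cong₂; subst; subst₂; module ≡-Reasoning)

[m%n+o]%n≡[m+o]%n : ∀ m o n .{{_ : NonZero n}} → (m % n + o) % n ≡ (m + o) % n
[m%n+o]%n≡[m+o]%n m o n = begin
  (m % n + o) % n         ≡⟨ %-distribˡ-+ (m % n) o n ⟩
  (m % n % n + o % n) % n ≡⟨ cong (λ r → (r + o % n) % n) (m%n%n≡m%n m n) ⟩
  (m % n + o % n) % n     ≡⟨ %-distribˡ-+ m o n ⟨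
  (m + o) % n             ∎
  where open ≡-Reasoning

[m+o%n]%n≡[m+o]%n : ∀ m o n .{{_ : NonZero n}} → (m + o % n) % n ≡ (m + o) % n
[m+o%n]%n≡[m+o]%n m o n = begin
  (m + o % n) % n ≡⟨ cong (_% n) (+-comm m (o % n)) ⟩
  (o % n + m) % n ≡⟨ [m%n+o]%n≡[m+o]%n o m n ⟩
  (o + m) % n     ≡⟨ cong (_% n) (+-comm o m) ⟩
  (m + o) % n     ∎
  where open ≡-Reasoning

%-cancelʳ-+ : ∀ x y b n .{{_ : NonZero n}} → (x + b) % n ≡ (y + b) % n → x % n ≡ y % n
%-cancelʳ-+ x y b n eq = begin
  x % n                 ≡⟨ [z+b+c]%n≡z%n x ⟨
  (x + b + c) % n       ≡⟨ [m%n+o]%n≡[m+o]%n (x + b) c n ⟨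
  ((x + b) % n + c) % n ≡⟨ cong (λ r → (r + c) % n) eq ⟩
  ((y + b) % n + c) % n ≡⟨ [m%n+o]%n≡[m+o]%n (y + b) c n ⟩
  (y + b + c) % n       ≡⟨ [z+b+c]%n≡z%n y ⟩
  y % n                 ∎
  where
  open ≡-Reasoning
  c : ℕ
  c = n ∸ b % n
  b+c≡n+[b/n]*n : b + c ≡ n + b / n * n
  b+c≡n+[b/n]*n = begin
    b + c                   ≡⟨ cong (_+ c) (m≡m%n+[m/n]*n b n) ⟩
    b % n + b / n * n + c   ≡⟨ +-comm (b % n + b / n * n) c ⟩
    c + (b % n + b / n * n) ≡⟨ +-assoc c (b % n) (b / n * n) ⟨
    c + b % n + b / n * n   ≡⟨ cong (_+ b / n * n) (m∸n+n≡m (m%n≤n b n)) ⟩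
    n + b / n * n           ∎
  [z+b+c]%n≡z%n : ∀ z → (z + b + c) % n ≡ z % n
  [z+b+c]%n≡z%n z = begin
    (z + b + c) % n               ≡⟨ cong (_% n) (+-assoc z b c) ⟩
    (z + (b + c)) % n             ≡⟨ cong (λ r → (z + r) % n) b+c≡n+[b/n]*n ⟩
    (z + suc (b / n) * n) % n     ≡⟨ [m+kn]%n≡m%n z (suc (b / n)) n ⟩
    z % n                         ∎

*2≢suc*2 : ∀ a b → a * 2 ≢ suc (b * 2)
*2≢suc*2 a b eq = even≢odd a b (trans (*-comm 2 a) (trans eq (cong suc (*-comm b 2))))

m<n∸o⇒o+m<n : ∀ m n o → m < n ∸ o → o + m < n
m<n∸o⇒o+m<n m n o m<n∸o = begin-strict
  o + m       <⟨ +-monoʳ-< o m<n∸o ⟩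
  o + (n ∸ o) ≡⟨ m+[n∸m]≡n (<⇒≤ (m∸n≢0⇒n<m {n} {o} (m<n⇒n≢0 m<n∸o))) ⟩
  n           ∎
  where open ≤-Reasoning

module Cycle (P : ℕ) .{{_ : NonZero P}} where

  suc-%-cases : ∀ {p} → p < P → (suc p < P × suc p % P ≡ suc p) ⊎ (suc p ≡ P × suc p % P ≡ 0)
  suc-%-cases p<P with m≤n⇒m<n∨m≡n p<P
  ... | inj₁ sp<P = inj₁ (sp<P , m<n⇒m%n≡m sp<P)
  ... | inj₂ refl = inj₂ (refl , n%n≡0 P)

  -- Within d p : min (p, P − p) ≤ d, i.e. position p of the P-cycle is within distance d of 0.
  Within : ℕ → ℕ → Set
  Within d p = p ≤ d ⊎ P ≤ p + d

  Within-suc : ∀ {d p} → p < P → Within d p → Within (suc d) (suc p % P)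
  Within-suc {d} {p} p<P w with suc-%-cases p<P
  ... | inj₂ (_ , eq) rewrite eq = inj₁ z≤n
  ... | inj₁ (_ , eq) rewrite eq with w
  ...   | inj₁ p≤d  = inj₁ (s≤s p≤d)
  ...   | inj₂ P≤p+d = inj₂ (≤-trans P≤p+d (+-mono-≤ (n≤1+n p) (n≤1+n d)))

  Within-pred : ∀ {d q} → q < P → Within d (suc q % P) → Within (suc d) q
  Within-pred {d} {q} q<P w with suc-%-cases q<P
  ... | inj₂ (sq≡P , eq) rewrite eq = inj₂ (subst (_≤ q + suc d) sq≡P (subst (suc q ≤_) (sym (+-suc q d)) (s≤s (m≤m+n q d))))
  ... | inj₁ (_ , eq) rewrite eq with w
  ...   | inj₁ sq≤d  = inj₁ (≤-trans (n≤1+n q) (m≤n⇒m≤1+n sq≤d))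
  ...   | inj₂ P≤sq+d = inj₂ (subst (P ≤_) (sym (+-suc q d)) P≤sq+d)

module Dihedral (n : ℕ) where

  m : ℕ
  m = suc n

  P : ℕ
  P = m * 2

  open Cycle P

  P≡m+m : P ≡ m + m
  P≡m+m = trans (*-comm m 2) (cong (m +_) (+-identityʳ m))

  reflect : ℕ → ℕ → ℕ
  reflect c a = (c + (m ∸ a)) % m

  reflect-+ : ∀ c {a} → a ≤ m → (reflect c a + a) % m ≡ c % m
  reflect-+ c {a} a≤m = begin
    ((c + (m ∸ a)) % m + a) % m ≡⟨ [m%n+o]%n≡[m+o]%n (c + (m ∸ a)) a m ⟩
    (c + (m ∸ a) + a) % m       ≡⟨ cong (_% m) (+-assoc c (m ∸ a) a) ⟩
    (c + (m ∸ a + a)) % m       ≡⟨ cong (λ r → (c + r) % m) (m∸n+n≡m a≤m) ⟩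
    (c + m) % m                 ≡⟨ [m+n]%n≡m%n c m ⟩
    c % m                       ∎
    where open ≡-Reasoning

  reflect-involutive : ∀ c {a} → a < m → reflect c (reflect c a) ≡ a
  reflect-involutive c {a} a<m = begin
    (c + (m ∸ r)) % m           ≡⟨ [m%n+o]%n≡[m+o]%n c (m ∸ r) m ⟨
    (c % m + (m ∸ r)) % m       ≡⟨ cong (λ v → (v + (m ∸ r)) % m) (reflect-+ c (<⇒≤ a<m)) ⟨
    ((r + a) % m + (m ∸ r)) % m ≡⟨ [m%n+o]%n≡[m+o]%n (r + a) (m ∸ r) m ⟩
    (r + a + (m ∸ r)) % m       ≡⟨ cong (λ v → (v + (m ∸ r)) % m) (+-comm r a) ⟩
    (a + r + (m ∸ r)) % m       ≡⟨ cong (_% m) (+-assoc a r (m ∸ r)) ⟩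
    (a + (r + (m ∸ r))) % m     ≡⟨ cong (λ v → (a + v) % m) (m+[n∸m]≡n (<⇒≤ (m%n<n (c + (m ∸ a)) m))) ⟩
    (a + m) % m                 ≡⟨ [m+n]%n≡m%n a m ⟩
    a % m                       ≡⟨ m<n⇒m%n≡m a<m ⟩
    a                           ∎
    where
    open ≡-Reasoning
    r : ℕ
    r = reflect c a

  reflect-injective : ∀ c {a b} → a < m → b < m → reflect c a ≡ reflect c b → a ≡ b
  reflect-injective c a<m b<m eq =
    trans (sym (reflect-involutive c a<m)) (trans (cong (reflect c) eq) (reflect-involutive c b<m))

  reflect-suc : ∀ c a → reflect (suc c % m) a ≡ suc (reflect c a) % m
  reflect-suc c a = begin
    (suc c % m + (m ∸ a)) % m  ≡⟨ [m%n+o]%n≡[m+o]%n (suc c) (m ∸ a) m ⟩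
    (1 + (c + (m ∸ a))) % m    ≡⟨ [m+o%n]%n≡[m+o]%n 1 (c + (m ∸ a)) m ⟨
    suc (reflect c a) % m      ∎
    where open ≡-Reasoning

  reflect-0-0 : reflect 0 0 ≡ 0
  reflect-0-0 = n%n≡0 m

  reflect-0-+ : ∀ {a} → suc a < m → reflect 0 (suc a) + suc a ≡ m
  reflect-0-+ {a} sa<m = begin
    (m ∸ suc a) % m + suc a ≡⟨ cong (_+ suc a) (m<n⇒m%n≡m (∸-monoʳ-< z<s (<⇒≤ sa<m))) ⟩
    m ∸ suc a + suc a       ≡⟨ m∸n+n≡m (<⇒≤ sa<m) ⟩
    m                       ∎
    where open ≡-Reasoning

  infixr 7 _·_
  _·_ : W m → W m → W m
  _·_ = mul m

  toℕ-mod : ∀ b → toℕ (b mod m) ≡ b % m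
  toℕ-mod b = toℕ-fromℕ< (m%n<n b m)

  mod≡ : ∀ b (a : Fin m) → b % m ≡ toℕ a → b mod m ≡ a
  mod≡ b a eq = toℕ-injective (trans (toℕ-mod b) eq)

  toℕ-gen· : ∀ g x → toℕ (proj₂ (gen m g · x)) ≡ reflect (toℕ (proj₂ (gen m g))) (toℕ (proj₂ x))
  toℕ-gen· s (_ , a) = toℕ-mod (m ∸ toℕ a)
  toℕ-gen· t (_ , a) = toℕ-mod (toℕ (1 mod m) + (m ∸ toℕ a))

  gen-involutive : ∀ g x → gen m g · gen m g · x ≡ x
  gen-involutive g (e , a) = cong₂ _,_ (orientation g) (toℕ-injective (begin
    toℕ (proj₂ (gen m g · gen m g · (e , a))) ≡⟨ toℕ-gen· g (gen m g · (e , a)) ⟩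
    reflect c (toℕ (proj₂ (gen m g · (e , a)))) ≡⟨ cong (reflect c) (toℕ-gen· g (e , a)) ⟩
    reflect c (reflect c (toℕ a))              ≡⟨ reflect-involutive c (toℕ<n a) ⟩
    toℕ a                                      ∎))
    where
    open ≡-Reasoning
    c : ℕ
    c = toℕ (proj₂ (gen m g))
    orientation : ∀ g → proj₁ (gen m g · gen m g · (e , a)) ≡ e
    orientation s = not-involutive e
    orientation t = not-involutive e

  gen·-injective : ∀ g {x y} → gen m g · x ≡ gen m g · y → x ≡ y
  gen·-injective g {x} {y} eq =
    trans (sym (gen-involutive g x)) (trans (cong (gen m g ·_) eq) (gen-involutive g y))

  ·s-flip : ∀ e a → (e , a) · gen m s ≡ (not e , a)
  ·s-flip false a = cong (true ,_) (mod≡ (toℕ a + 0) a (trans (cong (_% m) (+-identityʳ (toℕ a))) (m<n⇒m%n≡m (toℕ<n a))))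
  ·s-flip true a = cong (false ,_) (mod≡ (toℕ a + m) a (trans ([m+n]%n≡m%n (toℕ a) m) (m<n⇒m%n≡m (toℕ<n a))))

  s·s : gen m s · gen m s ≡ one m
  s·s = cong (false ,_) (mod≡ m fzero (n%n≡0 m))

  s·one : gen m s · one m ≡ gen m s
  s·one = cong (true ,_) (mod≡ m fzero (n%n≡0 m))

  -- The Cayley graph of W is the 2m-cycle ρ⁰, sρ⁰, ρ¹, sρ¹, …, where ρᵃ = (false , a) is
  -- x ↦ x + a and sρᵃ = (true , −a); pos w is the place of w on it.
  pos : W m → ℕ
  pos (false , a) = toℕ a * 2
  pos (true , a) = suc (reflect 0 (toℕ a) * 2)

  pos-< : ∀ x → pos x < P
  pos-< (false , a) = *-monoˡ-< 2 (toℕ<n a)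
  pos-< (true , a) = *-monoˡ-≤ 2 (m%n<n (m ∸ toℕ a) m)

  pos-injective : ∀ x y → pos x ≡ pos y → x ≡ y
  pos-injective (false , a) (false , b) eq = cong (false ,_) (toℕ-injective (*-cancelʳ-≡ _ _ 2 eq))
  pos-injective (true , a) (true , b) eq = cong (true ,_) (toℕ-injective
    (reflect-injective 0 (toℕ<n a) (toℕ<n b) (*-cancelʳ-≡ _ _ 2 (suc-injective eq))))
  pos-injective (false , a) (true , b) eq = ⊥-elim (*2≢suc*2 (toℕ a) (reflect 0 (toℕ b)) eq)
  pos-injective (true , a) (false , b) eq = ⊥-elim (*2≢suc*2 (toℕ b) (reflect 0 (toℕ a)) (sym eq))

  pos-s-rotation : ∀ a → pos (gen m s · (false , a)) ≡ suc (pos (false , a))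
  pos-s-rotation a = cong (λ r → suc (r * 2)) (begin
    reflect 0 (toℕ ((m ∸ toℕ a) mod m)) ≡⟨ cong (reflect 0) (toℕ-mod (m ∸ toℕ a)) ⟩
    reflect 0 (reflect 0 (toℕ a))       ≡⟨ reflect-involutive 0 (toℕ<n a) ⟩
    toℕ a                               ∎)
    where open ≡-Reasoning

  pos-s-reflection : ∀ a → pos (true , a) ≡ suc (pos (gen m s · (true , a)))
  pos-s-reflection a = cong (λ r → suc (r * 2)) (sym (toℕ-mod (m ∸ toℕ a)))

  pos-t-reflection : ∀ a → pos (gen m t · (true , a)) ≡ suc (pos (true , a)) % P
  pos-t-reflection a = begin
    toℕ (proj₂ (gen m t · (true , a))) * 2   ≡⟨ cong (_* 2) (toℕ-gen· t (true , a)) ⟩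
    reflect (toℕ (1 mod m)) (toℕ a) * 2      ≡⟨ cong (λ c → reflect c (toℕ a) * 2) (toℕ-mod 1) ⟩
    reflect (1 % m) (toℕ a) * 2              ≡⟨ cong (_* 2) (reflect-suc 0 (toℕ a)) ⟩
    suc (reflect 0 (toℕ a)) % m * 2          ≡⟨ m%n*o≡m*o%[n*o] (suc (reflect 0 (toℕ a))) m 2 ⟩
    suc (pos (true , a)) % P                 ∎
    where open ≡-Reasoning

  ascent : W m → Gen
  ascent (false , _) = s
  ascent (true , _) = t

  descent : W m → Gen
  descent (false , _) = t
  descent (true , _) = s

  pos-ascent : ∀ x → pos (gen m (ascent x) · x) ≡ suc (pos x) % P
  pos-ascent (false , a) = trans (pos-s-rotation a) (sym (m<n⇒m%n≡m (*-monoˡ-≤ 2 (toℕ<n a))))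
  pos-ascent (true , a) = pos-t-reflection a

  -- Since generators are involutions, a descent step is an ascent step backwards.
  pos-descent : ∀ x → suc (pos (gen m (descent x) · x)) % P ≡ pos x
  pos-descent x@(false , _) = trans (sym (pos-ascent (gen m t · x))) (cong pos (gen-involutive t x))
  pos-descent x@(true , _) = trans (sym (pos-ascent (gen m s · x))) (cong pos (gen-involutive s x))

  pos-neighbour : ∀ g x → pos (gen m g · x) ≡ suc (pos x) % P ⊎ suc (pos (gen m g · x)) % P ≡ pos x
  pos-neighbour s x@(false , _) = inj₁ (pos-ascent x)
  pos-neighbour t x@(true , _) = inj₁ (pos-ascent x)
  pos-neighbour t x@(false , _) = inj₂ (pos-descent x)
  pos-neighbour s x@(true , _) = inj₂ (pos-descent x)

  Within-eval : ∀ w → Within (length w) (pos (eval m w))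
  Within-eval [] = inj₁ z≤n
  Within-eval (g ∷ w) with pos-neighbour g (eval m w)
  ... | inj₁ up = subst (Within _) (sym up) (Within-suc (pos-< (eval m w)) (Within-eval w))
  ... | inj₂ down = Within-pred (pos-< (gen m g · eval m w)) (subst (Within _) (sym down) (Within-eval w))

  Within⇒≤ : ∀ {d p} → p ≤ m → Within d p → p ≤ d
  Within⇒≤ p≤m (inj₁ p≤d) = p≤d
  Within⇒≤ {d} {p} p≤m (inj₂ P≤p+d) = ≤-trans p≤m (+-cancelˡ-≤ m m d (begin
    m + m ≡⟨ P≡m+m ⟨
    P     ≤⟨ P≤p+d ⟩
    p + d ≤⟨ +-monoˡ-≤ d p≤m ⟩
    m + d ∎))
    where open ≤-Reasoning

  Within⇒∸≤ : ∀ {d p} → m ≤ p → Within d p → P ∸ p ≤ d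
  Within⇒∸≤ {d} {p} m≤p (inj₁ p≤d) = ≤-trans (m≤n+o⇒m∸n≤o P p P≤p+m) (≤-trans m≤p p≤d)
    where
    P≤p+m : P ≤ p + m
    P≤p+m = subst (_≤ p + m) (sym P≡m+m) (+-monoˡ-≤ m m≤p)
  Within⇒∸≤ {d} {p} m≤p (inj₂ P≤p+d) = m≤n+o⇒m∸n≤o P p P≤p+d

  ascending : ∀ d → Σ (List Gen) λ w → length w ≡ d × pos (eval m w) ≡ d % P
  ascending zero = [] , refl , refl
  ascending (suc d) with ascending d
  ... | w , refl , eq = ascent (eval m w) ∷ w , refl , (begin
    pos (gen m (ascent (eval m w)) · eval m w) ≡⟨ pos-ascent (eval m w) ⟩
    suc (pos (eval m w)) % P                  ≡⟨ cong (λ p → suc p % P) eq ⟩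
    (1 + d % P) % P                           ≡⟨ [m+o%n]%n≡[m+o]%n 1 d P ⟩
    suc d % P                                 ∎)
    where open ≡-Reasoning

  descending : ∀ d → Σ (List Gen) λ w → length w ≡ d × (pos (eval m w) + d) % P ≡ 0
  descending zero = [] , refl , refl
  descending (suc d) with descending d
  ... | w , refl , eq = descent x ∷ w , refl , (begin
    (pos y + suc d) % P           ≡⟨ cong (_% P) (+-suc (pos y) d) ⟩
    (suc (pos y) + d) % P         ≡⟨ [m%n+o]%n≡[m+o]%n (suc (pos y)) d P ⟨
    (suc (pos y) % P + d) % P     ≡⟨ cong (λ p → (p + d) % P) (pos-descent x) ⟩
    (pos x + d) % P               ≡⟨ eq ⟩
    0                             ∎)
    where
    open ≡-Reasoning
    x y : W m
    x = eval m w
    y = gen m (descent x) · x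

  IsLength-pos≤ : ∀ x → pos x ≤ m → IsLength m x (pos x)
  IsLength-pos≤ x p≤m with ascending (pos x)
  ... | w , len , eq = (w , len , pos-injective _ x (trans eq (m<n⇒m%n≡m (pos-< x))))
                     , λ v ev → Within⇒≤ p≤m (subst (Within _ ∘ pos) ev (Within-eval v))

  IsLength-pos≥ : ∀ x → m ≤ pos x → IsLength m x (P ∸ pos x)
  IsLength-pos≥ x m≤p with descending (P ∸ pos x)
  ... | w , len , eq = (w , len , pos-injective _ x same-pos)
                     , λ v ev → Within⇒∸≤ m≤p (subst (Within _ ∘ pos) ev (Within-eval v))
    where
    open ≡-Reasoning
    same-pos : pos (eval m w) ≡ pos x
    same-pos = begin
      pos (eval m w)     ≡⟨ m<n⇒m%n≡m (pos-< (eval m w)) ⟨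
      pos (eval m w) % P ≡⟨ %-cancelʳ-+ (pos (eval m w)) (pos x) (P ∸ pos x) P (begin
        (pos (eval m w) + (P ∸ pos x)) % P ≡⟨ eq ⟩
        0                                  ≡⟨ n%n≡0 P ⟨
        P % P                              ≡⟨ cong (_% P) (m+[n∸m]≡n (<⇒≤ (pos-< x))) ⟨
        (pos x + (P ∸ pos x)) % P          ∎) ⟩
      pos x % P          ≡⟨ m<n⇒m%n≡m (pos-< x) ⟩
      pos x              ∎

  IsLength-unique : ∀ {x a b} → IsLength m x a → IsLength m x b → a ≡ b
  IsLength-unique ((w , refl , ev) , minimal) ((w′ , refl , ev′) , minimal′) =
    ≤-antisym (minimal w′ ev′) (minimal′ w ev)

  -- Mirror p q : q is the image of p under the reflection p ↦ 1 − p of the P-cycle.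
  Mirror : ℕ → ℕ → Set
  Mirror p q = p + q ≡ 1 ⊎ p + q ≡ suc P

  Mirror-sym : ∀ p q → Mirror p q → Mirror q p
  Mirror-sym p q = Sum.map (trans (+-comm q p)) (trans (+-comm q p))

  Mirror-rotation-reflection : ∀ a → Mirror (pos (false , a)) (pos (true , a))
  Mirror-rotation-reflection fzero = inj₁ (cong (λ r → suc (r * 2)) reflect-0-0)
  Mirror-rotation-reflection (fsuc a) = inj₂ (begin
    suc (toℕ a) * 2 + suc (r * 2) ≡⟨ +-suc (suc (toℕ a) * 2) (r * 2) ⟩
    suc (suc (toℕ a) * 2 + r * 2) ≡⟨ cong suc (*-distribʳ-+ 2 (suc (toℕ a)) r) ⟨
    suc ((suc (toℕ a) + r) * 2)   ≡⟨ cong (λ v → suc (v * 2)) (+-comm (suc (toℕ a)) r) ⟩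
    suc ((r + suc (toℕ a)) * 2)   ≡⟨ cong (λ v → suc (v * 2)) (reflect-0-+ (toℕ<n (fsuc a))) ⟩
    suc P                         ∎)
    where
    open ≡-Reasoning
    r : ℕ
    r = reflect 0 (suc (toℕ a))

  Mirror-·s : ∀ x → Mirror (pos x) (pos (x · gen m s))
  Mirror-·s (false , a) =
    subst (Mirror (pos (false , a)) ∘ pos) (sym (·s-flip false a)) (Mirror-rotation-reflection a)
  Mirror-·s (true , a) =
    subst (Mirror (pos (true , a)) ∘ pos) (sym (·s-flip true a)) (Mirror-sym (pos (false , a)) (pos (true , a)) (Mirror-rotation-reflection a))

  J : Subset m
  J s = true
  J t = false

  InMinCoset-lengths : ∀ {x a b} → IsLength m x a → IsLength m (x · gen m s) b → a < b → InMinCoset m J x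
  InMinCoset-lengths ℓx ℓxs a<b s _ _ _ ℓx′ ℓxs′ = subst₂ _<_ (IsLength-unique ℓx ℓx′) (IsLength-unique ℓxs ℓxs′) a<b

  ¬InMinCoset-lengths : ∀ {x a b} → IsLength m x a → IsLength m (x · gen m s) b → b ≤ a → ¬ InMinCoset m J x
  ¬InMinCoset-lengths ℓx ℓxs b≤a minimal = ≤⇒≯ b≤a (minimal s refl _ _ ℓx ℓxs)

  InMinCoset-one : InMinCoset m J (one m)
  InMinCoset-one = InMinCoset-lengths (IsLength-pos≤ (one m) z≤n) ℓs z<s
    where
    pos-s : pos (gen m s) ≡ 1
    pos-s = cong (λ r → suc (r * 2)) reflect-0-0
    ℓs : IsLength m (gen m s) 1
    ℓs = subst (IsLength m (gen m s)) pos-s (IsLength-pos≤ (gen m s) (subst (_≤ m) (sym pos-s) (s≤s z≤n)))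

  mirror-≤ : ∀ {p q} → p + q ≡ suc P → p ≤ m → m < q
  mirror-≤ {p} {q} eq p≤m = +-cancelˡ-≤ m (suc m) q (begin
    m + suc m     ≡⟨ +-suc m m ⟩
    suc (m + m)   ≡⟨ cong suc P≡m+m ⟨
    suc P         ≡⟨ eq ⟨
    p + q         ≤⟨ +-monoˡ-≤ q p≤m ⟩
    m + q         ∎)
    where open ≤-Reasoning

  mirror-> : ∀ {p q} → p + q ≡ suc P → m < p → q ≤ m
  mirror-> {p} {q} eq m<p = +-cancelˡ-≤ m q m (≤-pred (begin
    suc m + q     ≤⟨ +-monoˡ-≤ q m<p ⟩
    p + q         ≡⟨ eq ⟩
    suc P         ≡⟨ cong suc P≡m+m ⟩
    suc (m + m)   ∎))
    where open ≤-Reasoning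

  InMinCoset-pos> : ∀ x → m < pos x → InMinCoset m J x
  InMinCoset-pos> x m<p with Mirror-·s x
  ... | inj₁ p+q≡1 = ⊥-elim (<⇒≱ (≤-trans (s≤s (s≤s z≤n)) m<p) (subst (pos x ≤_) p+q≡1 (m≤m+n _ _)))
  ... | inj₂ p+q≡sucP = InMinCoset-lengths (IsLength-pos≥ x (<⇒≤ m<p)) (IsLength-pos≤ xs (mirror-> p+q≡sucP m<p))
    (begin-strict
      P ∸ pos x       <⟨ n<1+n (P ∸ pos x) ⟩
      suc (P ∸ pos x) ≡⟨ +-∸-assoc 1 (<⇒≤ (pos-< x)) ⟨
      suc P ∸ pos x   ≤⟨ m≤n+o⇒m∸n≤o (suc P) (pos x) (≤-reflexive (sym p+q≡sucP)) ⟩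
      pos xs          ∎)
    where
    open ≤-Reasoning
    xs : W m
    xs = x · gen m s

  ¬InMinCoset-pos≤ : ∀ x → 0 < pos x → pos x ≤ m → ¬ InMinCoset m J x
  ¬InMinCoset-pos≤ x 0<p p≤m with Mirror-·s x
  ... | inj₁ p+q≡1 = ¬InMinCoset-lengths (IsLength-pos≤ x p≤m) (IsLength-pos≤ xs (≤-trans q≤p p≤m)) q≤p
    where
    xs : W m
    xs = x · gen m s
    q≤p : pos xs ≤ pos x
    q≤p = ≤-trans (+-cancelˡ-≤ 1 (pos xs) 0 (≤-trans (+-monoˡ-≤ (pos xs) 0<p) (≤-reflexive p+q≡1))) z≤n
  ... | inj₂ p+q≡sucP = ¬InMinCoset-lengths (IsLength-pos≤ x p≤m) (IsLength-pos≥ xs (<⇒≤ (mirror-≤ p+q≡sucP p≤m)))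
    (m≤n+o⇒m∸n≤o P (pos xs) (≤-trans (n≤1+n P) (≤-reflexive (trans (sym p+q≡sucP) (+-comm (pos x) (pos xs))))))
    where
    xs : W m
    xs = x · gen m s

  ParabolicAbelian-J : ParabolicAbelian m J
  ParabolicAbelian-J u v (w , Jw , refl) (w′ , Jw′ , refl) = commute (parabolic w Jw) (parabolic w′ Jw′)
    where
    parabolic : ∀ w → All (λ g → J g ≡ true) w → eval m w ≡ one m ⊎ eval m w ≡ gen m s
    parabolic [] [] = inj₁ refl
    parabolic (s ∷ w) (_ ∷ Jw) with parabolic w Jw
    ... | inj₁ eq = inj₂ (trans (cong (gen m s ·_) eq) s·one)
    ... | inj₂ eq = inj₁ (trans (cong (gen m s ·_) eq) s·s)
    commute : ∀ {u v} → u ≡ one m ⊎ u ≡ gen m s → v ≡ one m ⊎ v ≡ gen m s → u · v ≡ v · u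
    commute (inj₁ refl) (inj₁ refl) = refl
    commute (inj₁ refl) (inj₂ refl) = sym s·one
    commute (inj₂ refl) (inj₁ refl) = s·one
    commute (inj₂ refl) (inj₂ refl) = refl

  Independent-orientation : ∀ e L → (∀ {x} → x ∈ L → proj₁ x ≡ e) → Independent m L
  Independent-orientation e L oriented x y x∈L y∈L (s , refl) = not-¬ (oriented y∈L) (cong not (oriented x∈L))
  Independent-orientation e L oriented x y x∈L y∈L (t , refl) = not-¬ (oriented y∈L) (cong not (oriented x∈L))

  rotation-index : ∀ k → Fin (n ∸ k) → Fin m
  rotation-index k i = fromℕ< (s≤s (m<n∸o⇒o+m<n (toℕ i) n k (toℕ<n i)))

  toℕ-rotation-index : ∀ k i → toℕ (rotation-index k i) ≡ suc k + toℕ i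
  toℕ-rotation-index k i = toℕ-fromℕ< (s≤s (m<n∸o⇒o+m<n (toℕ i) n k (toℕ<n i)))

  rotationsAbove : ℕ → List (W m)
  rotationsAbove k = tabulate λ i → false , rotation-index k i

  rotationsAbove-unique : ∀ k → Unique (rotationsAbove k)
  rotationsAbove-unique k = Unique.tabulate⁺ λ {i} {j} eq → toℕ-injective (+-cancelˡ-≡ (suc k) _ _
    (trans (sym (toℕ-rotation-index k i)) (trans (cong (toℕ ∘ proj₂) eq) (toℕ-rotation-index k j))))

  ∈-rotationsAbove⁺ : ∀ {k} c → k < toℕ c → (false , c) ∈ rotationsAbove k
  ∈-rotationsAbove⁺ {k} c k<c = subst (_∈ rotationsAbove k) (cong (false ,_) (toℕ-injective (begin
      toℕ (rotation-index k i)         ≡⟨ toℕ-rotation-index k i ⟩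
      suc k + toℕ i                    ≡⟨ cong (suc k +_) (toℕ-fromℕ< i<n∸k) ⟩
      suc k + (toℕ c ∸ suc k)          ≡⟨ m+[n∸m]≡n k<c ⟩
      toℕ c                            ∎)))
    (∈-tabulate⁺ i)
    where
    open ≡-Reasoning
    i<n∸k : toℕ c ∸ suc k < n ∸ k
    i<n∸k = ∸-monoˡ-< (toℕ<n c) k<c
    i : Fin (n ∸ k)
    i = fromℕ< i<n∸k

  ∈-rotationsAbove⁻ : ∀ {k x} → x ∈ rotationsAbove k → ∃ λ c → x ≡ (false , c) × k < toℕ c
  ∈-rotationsAbove⁻ {k} x∈ with ∈-tabulate⁻ x∈
  ... | i , refl = _ , refl , subst (k <_) (sym (toℕ-rotation-index k i)) (s≤s (m≤m+n k (toℕ i)))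

module Odd (k : ℕ) where

  open Dihedral (2 * k) public

  m≤c*2⇒k<c : ∀ {c} → m ≤ c * 2 → k < c
  m≤c*2⇒k<c {c} m≤c*2 = *-cancelʳ-< 2 k c (subst (λ v → suc v ≤ c * 2) (*-comm 2 k) m≤c*2)

  k<c⇒m<c*2 : ∀ {c} → k < c → m < c * 2
  k<c⇒m<c*2 {c} k<c = subst (λ v → suc (suc v) ≤ c * 2) (*-comm k 2) (*-monoˡ-≤ 2 k<c)

  R : List (W m)
  R = rotationsAbove k

  A B : List (W m)
  A = one m ∷ R
  B = map (gen m s ·_) R

  Unique-A : Unique A
  Unique-A = All.tabulate one∉R ∷ rotationsAbove-unique k
    where
    one∉R : ∀ {x} → x ∈ R → one m ≢ x
    one∉R x∈R one≡x with ∈-rotationsAbove⁻ x∈R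
    ... | c , refl , k<c = n≮0 (subst (k <_) (sym (cong (toℕ ∘ proj₂) one≡x)) k<c)

  Unique-B : Unique B
  Unique-B = Unique.map⁺ (gen·-injective s) (rotationsAbove-unique k)

  orientation-A : ∀ {x} → x ∈ A → proj₁ x ≡ false
  orientation-A (here refl) = refl
  orientation-A (there x∈R) with ∈-rotationsAbove⁻ x∈R
  ... | _ , refl , _ = refl

  orientation-B : ∀ {x} → x ∈ B → proj₁ x ≡ true
  orientation-B x∈B with ∈-map⁻ (gen m s ·_) x∈B
  ... | y , y∈R , refl with ∈-rotationsAbove⁻ y∈R
  ...   | _ , refl , _ = refl

  disjoint : ∀ x → x ∈ A → x ∈ B → ⊥
  disjoint x x∈A x∈B with trans (sym (orientation-A x∈A)) (orientation-B x∈B)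
  ... | ()

  sound-A : ∀ x → x ∈ A → InMinCoset m J x
  sound-A x (here refl) = InMinCoset-one
  sound-A x (there x∈R) with ∈-rotationsAbove⁻ x∈R
  ... | c , refl , k<c = InMinCoset-pos> x (k<c⇒m<c*2 k<c)

  sound-B : ∀ x → x ∈ B → InMinCoset m J x
  sound-B x x∈B with ∈-map⁻ (gen m s ·_) x∈B
  ... | y , y∈R , refl with ∈-rotationsAbove⁻ y∈R
  ...   | c , refl , k<c = InMinCoset-pos> x (subst (m <_) (sym (pos-s-rotation c)) (m<n⇒m<1+n (k<c⇒m<c*2 k<c)))

  cover-beyond-m : ∀ x → m < pos x → x ∈ A ⊎ x ∈ B
  cover-beyond-m (false , c) m<p = inj₁ (there (∈-rotationsAbove⁺ c (m≤c*2⇒k<c (<⇒≤ m<p))))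
  cover-beyond-m x@(true , a) m<p =
    inj₂ (subst (_∈ B) (gen-involutive s x) (∈-map⁺ (gen m s ·_) (∈-rotationsAbove⁺ (proj₂ (gen m s · x)) (m≤c*2⇒k<c m≤p′))))
    where
    m≤p′ : m ≤ pos (gen m s · x)
    m≤p′ = ≤-pred (subst (m <_) (pos-s-reflection a) m<p)

  cover : ∀ x → InMinCoset m J x → x ∈ A ⊎ x ∈ B
  cover x x∈W^J with m <? pos x
  ... | yes m<p = cover-beyond-m x m<p
  ... | no m≮p = inj₁ (here (pos-injective x (one m) (n≤0⇒n≡0 (≮⇒≥ λ 0<p → ¬InMinCoset-pos≤ x 0<p (≮⇒≥ m≮p) x∈W^J))))

  |B|<|A| : length B < length A
  |B|<|A| = s≤s (≤-reflexive (length-map (gen m s ·_) R))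

theorem6p5 : (k : ℕ) → CubeLike (suc (2 * k))
theorem6p5 k =
  J , ParabolicAbelian-J , A , B ,
  ( Unique-A , Unique-B , cover , sound-A , sound-B , disjoint
  , Independent-orientation false A orientation-A , Independent-orientation true B orientation-B ) ,
  |B|<|A|
  where open Odd k
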